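{- Let $n,h\in\mathbb{N}$, $\mu>0$, and $0<\varepsilon,\beta\leq\mu/10$ with $\beta\in[0,1]$. Let $H$ be an $h$-vertex graph and $G$ an $n$-vertex graph with $\delta(G)\geq\left(1-\frac{2}{f(H)}+\mu\right)n$. Let $V(G)=V_0\cup V_1\cup\dots\cup V_k$ together with a spanning subgraph $G'\subseteq G$ satisfy properties (1)–(5) below, and let $R_{\beta,\varepsilon}$ be the corresponding reduced graph. Then for every $V_i\in V(R_{\beta,\varepsilon})$ we have $d_{R_{\beta,\varepsilon}}(V_i)\geq 2\left(1-\frac{2}{f(H)}+\frac{\mu}{2}\right)k$, where a double-edge is counted as two edges.
   Context: Properties: (1) $1/\varepsilon\leq k\leq N(\varepsilon)$, where $N(\varepsilon)$ is the constant of the degree form of Szemerédi's regularity lemma; (2) $|V_i|\leq\varepsilon n$ for all $i\in[0,k]$ and $|V_1|=\dots=|V_k|=m$; (3) $d_{G'}(v)>d_G(v)-(\beta+\varepsilon)n$ for all $v\in V(G)$; (4) each $V_i$, $i\in[k]$, is independent in $G'$; (5) for distinct $i,j\in[k]$, the pair $(V_i,V_j)$ is $\varepsilon$-regular in $G'$ with density $0$ or at least $\beta$. Here $d(X,Y)=e(X,Y)/(|X||Y|)$, and $(V_i,V_j)$ is $\varepsilon$-regular if $|d(X,Y)-d(V_i,V_j)|\leq\varepsilon$ for all $X\subseteq V_i$, $Y\subseteq V_j$ with $|X|\geq\varepsilon|V_i|$, $|Y|\geq\varepsilon|V_j|$. The reduced graph $R_{\beta,\varepsilon}$ is the multigraph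 on vertex set $\{V_1,\dots,V_k\}$ with a double-edge between $V_i,V_j$ if $d_{G'}(V_i,V_j)\geq\frac12+\beta$, a single edge if $\beta\leq d_{G'}(V_i,V_j)<\frac12+\beta$, and no edge otherwise. The vertex arboricity $ar(H)$ is the minimum $r$ such that $V(H)$ partitions into $r$ sets each inducing a forest (an acyclic partition); $\widetilde{\mathcal{H}}$ is the family of graphs $H$ having an acyclic partition $\{T_1,\dots,T_r\}$, $r=ar(H)$, with $T_1$ independent and $|T_i|=2|T_1|$ for $i\in[2,r]$; $f(H)=2ar(H)-1$ if $H\in\widetilde{\mathcal{H}}$, else $f(H)=2ar(H)$.
   Formalization: The parameters μ, ε and β range over the rationals. -}

module Defs where

open import Data.Nat as ℕ using (ℕ; zero; suc; _∸_)
open import Data.Bool using (Bool; true; false; if_then_else_; _∧_)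
open import Data.Fin using (Fin; zero; suc; inject₁; fromℕ)
open import Data.Fin.Properties using () renaming (_≟_ to _≟ᶠ_)
open import Data.Integer using (+_)
open import Data.Rational using (ℚ; 0ℚ; 1ℚ; _≤_; _<_; _/_; 1/_; Positive; positive)
  renaming (_+_ to _+ℚ_; _*_ to _*ℚ_)
open import Data.Rational.Properties using (_≤?_; _<?_; pos⇒nonZero)
open import Data.Product using (Σ; _×_; ∃; ∃-syntax)
open import Data.Empty using (⊥)
import Data.Sum
open import Function.Definitions using (Injective)
open import Relation.Binary.PropositionalEquality using (_≡_; _≢_)
open import Relation.Nullary using (¬_; yes; no; does)

record Graph (n : ℕ) : Set where
  field
    adj   : Fin n → Fin n → Bool
    sym   : ∀ u v → adj u v ≡ adj v u
    irrefl : ∀ v → adj v v ≡ false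
open Graph public

sumFin : (n : ℕ) → (Fin n → ℕ) → ℕ
sumFin zero    f = 0
sumFin (suc n) f = f zero ℕ.+ sumFin n (λ i → f (suc i))

indicator : Bool → ℕ
indicator b = if b then 1 else 0

VSet : ℕ → Set
VSet n = Fin n → Bool

_⊆_ : ∀ {n} → VSet n → VSet n → Set
X ⊆ Y = ∀ v → X v ≡ true → Y v ≡ true

card : ∀ {n} → VSet n → ℕ
card {n} X = sumFin n (λ v → indicator (X v))

deg : ∀ {n} → Graph n → Fin n → ℕ
deg {n} G v = sumFin n (λ u → indicator (adj G v u))

eCount : ∀ {n} → Graph n → VSet n → VSet n → ℕ
eCount {n} G X Y = sumFin n (λ x → sumFin n (λ y → indicator (X x ∧ Y y ∧ adj G x y)))

toℚ : ℕ → ℚ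
toℚ k = + k / 1

-- ratio a / b in ℚ (0 when b = 0; only used with b > 0 in the theorem)
ratio : ℕ → ℕ → ℚ
ratio a zero    = 0ℚ
ratio a (suc b) = + a / suc b

density : ∀ {n} → Graph n → VSet n → VSet n → ℚ
density G X Y = ratio (eCount G X Y) (card X ℕ.* card Y)

-- 2 / f  (f ≥ 1 in the theorem)
twoOver : ℕ → ℚ
twoOver zero    = 0ℚ
twoOver (suc f) = + 2 / suc f

recip : (p : ℚ) → 0ℚ < p → ℚ
recip p p>0 = (1/ p) {{pos⇒nonZero p {{positive p>0}}}}

absℚ : ℚ → ℚ
absℚ = Data.Rational.∣_∣

_⊑_ : ∀ {n} → Graph n → Graph n → Set
G' ⊑ G = ∀ u v → adj G' u v ≡ true → adj G u v ≡ true

IsRegular : ∀ {n} → Graph n → ℚ → VSet n → VSet n → Set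
IsRegular {n} G ε A B =
  ∀ (X Y : VSet n) → X ⊆ A → Y ⊆ B →
    ε *ℚ toℚ (card A) ≤ toℚ (card X) →
    ε *ℚ toℚ (card B) ≤ toℚ (card Y) →
    absℚ (density G X Y Data.Rational.- density G A B) ≤ ε

-- A cycle of length (3 + l): distinct vertices c 0, …, c (l+2) with
-- c i ~ c (i+1) and c (l+2) ~ c 0.
record Cycle {h : ℕ} (H : Graph h) : Set where
  field
    len₃  : ℕ
    vtx   : Fin (suc (suc (suc len₃))) → Fin h
    inj   : Injective _≡_ _≡_ vtx
    step  : ∀ (i : Fin (suc (suc len₃))) → adj H (vtx (inject₁ i)) (vtx (suc i)) ≡ true
    close : adj H (vtx (fromℕ (suc (suc len₃)))) (vtx zero) ≡ true
open Cycle public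

-- A partition of V(H) into r (labelled) parts T_a = χ⁻¹(a) is acyclic if
-- every part induces a forest, i.e. no cycle of H lies inside one part.
IsAcyclicPartition : ∀ {h} → Graph h → (r : ℕ) → (Fin h → Fin r) → Set
IsAcyclicPartition H r χ =
  ∀ (C : Cycle H) → ¬ (∃[ a ] (∀ i → χ (vtx C i) ≡ a))

HasAcyclicPartition : ∀ {h} → Graph h → ℕ → Set
HasAcyclicPartition {h} H r = ∃[ χ ] IsAcyclicPartition H r χ

IsVertexArboricity : ∀ {h} → Graph h → ℕ → Set
IsVertexArboricity H r =
  HasAcyclicPartition H r × (∀ r' → r' ℕ.< r → ¬ HasAcyclicPartition H r')

partSize : ∀ {h r} → (Fin h → Fin r) → Fin r → ℕ
partSize {h} χ a = sumFin h (λ v → indicator (does (χ v ≟ᶠ a)))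

-- H ∈ H̃ (given r = ar(H)): an acyclic partition {T_1,…,T_r} with T_1
-- (here label zero) independent and |T_i| = 2|T_1| for the other parts.
InHtilde : ∀ {h} → Graph h → ℕ → Set
InHtilde H zero    = ⊥
InHtilde {h} H (suc r') =
  Σ (Fin h → Fin (suc r')) λ χ →
    IsAcyclicPartition H (suc r') χ ×
    (∀ u v → χ u ≡ zero → χ v ≡ zero → adj H u v ≡ false) ×
    (∀ (i : Fin r') → partSize χ (suc i) ≡ 2 ℕ.* partSize χ zero)

IsF : ∀ {h} → Graph h → ℕ → Set
IsF H fH = ∃[ r ] (IsVertexArboricity H r ×
  ((InHtilde H r × fH ≡ 2 ℕ.* r ∸ 1) Data.Sum.⊎ (¬ InHtilde H r × fH ≡ 2 ℕ.* r)))

-- part V_i (i ∈ [0,k]) of a partition cls : V(G) → Fin (suc k); label zero is V_0,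
-- label suc j is V_{j+1}.
part : ∀ {n k} → (Fin n → Fin (suc k)) → Fin (suc k) → VSet n
part cls i v = does (cls v ≟ᶠ i)

half : ℚ
half = + 1 / 2

edgeMult : ℚ → ℚ → ℕ
edgeMult β d with (half +ℚ β) ≤? d
... | yes _ = 2
... | no _ with β ≤? d
...   | yes _ = 1
...   | no _  = 0

-- degree of V_i (i ∈ [k], given as j : Fin k for V_{j+1}) in R_{β,ε},
-- double-edges counted twice
reducedDeg : ∀ {n k} → Graph n → ℚ → (Fin n → Fin (suc k)) → Fin k → ℕ
reducedDeg {n} {k} G' β cls i =
  sumFin k (λ j → if does (i ≟ᶠ j) then 0
                   else edgeMult β (density G' (part cls (suc i)) (part cls (suc j))))

{-# OPTIONS --safe #-}
module Submission where

-- Double count the G'-edges leaving a cluster Vᵢ of size m.  Each of its vertices has G'-degree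
-- above (1 - 2/f(H) + μ - β - ε)n.  On the other hand Vᵢ is independent, sends at most εmn edges
-- into V₀, and at most (w/2 + β)m² edges into any other Vⱼ, where w ∈ {0,1,2} is the multiplicity
-- of VᵢVⱼ in R (the density is below β, below ½ + β, or at most 1).  Dividing by m and using
-- km ≤ n yields (1 - 2/f(H) + μ - 2β - 2ε)k ≤ d_R(Vᵢ)/2 + βk whenever the coefficient on the left
-- is nonnegative (otherwise the claim is trivial), and 2β + 2ε ≤ μ/2 finishes.  Clusters are
-- nonempty: otherwise n = |V₀| ≤ εn forces ε ≥ 1, whereas the degree condition forces μ ≤ 2.

module NatToℚ where
  open import Defs using (toℚ; ratio)
  open import Data.Nat as ℕ using (suc)
  open import Data.Nat.Properties using (m+[n∸m]≡n)
  open import Data.Integer as ℤ using (+_)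
  open import Data.Integer.Properties using (pos-+; pos-*)
  open import Data.Integer.Tactic.RingSolver using (solve-∀)
  open import Data.Rational using (ℚ; 0ℚ; _+_; _*_; _≤_; _<_; toℚᵘ)
  open import Data.Rational.Properties
  import Data.Rational.Unnormalised as ℚᵘ
  import Data.Rational.Unnormalised.Properties as ℚᵘ
  open import Relation.Binary.PropositionalEquality

  private
    toℚᵘ-toℚ : ∀ a → toℚᵘ (toℚ a) ℚᵘ.≃ ℚᵘ.mkℚᵘ (+ a) 0
    toℚᵘ-toℚ a = toℚᵘ-fromℚᵘ (ℚᵘ.mkℚᵘ (+ a) 0)

  toℚ-+ : ∀ a b → toℚ (a ℕ.+ b) ≡ toℚ a + toℚ b
  toℚ-+ a b = toℚᵘ-injective (begin-equality
    toℚᵘ (toℚ (a ℕ.+ b))                     ≃⟨ toℚᵘ-toℚ (a ℕ.+ b) ⟩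
    ℚᵘ.mkℚᵘ (+ (a ℕ.+ b)) 0                  ≃⟨ ℚᵘ.*≡* (trans (cong (ℤ._* + 1) (pos-+ a b)) (distrib (+ a) (+ b))) ⟩
    ℚᵘ.mkℚᵘ (+ a) 0 ℚᵘ.+ ℚᵘ.mkℚᵘ (+ b) 0     ≃⟨ ℚᵘ.+-cong (toℚᵘ-toℚ a) (toℚᵘ-toℚ b) ⟨
    toℚᵘ (toℚ a) ℚᵘ.+ toℚᵘ (toℚ b)           ≃⟨ toℚᵘ-homo-+ (toℚ a) (toℚ b) ⟨
    toℚᵘ (toℚ a + toℚ b)                     ∎)
    where
    open ℚᵘ.≤-Reasoning
    distrib : ∀ x y → (x ℤ.+ y) ℤ.* + 1 ≡ (x ℤ.* + 1 ℤ.+ y ℤ.* + 1) ℤ.* + 1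
    distrib = solve-∀

  toℚ-* : ∀ a b → toℚ (a ℕ.* b) ≡ toℚ a * toℚ b
  toℚ-* a b = toℚᵘ-injective (begin-equality
    toℚᵘ (toℚ (a ℕ.* b))                     ≃⟨ toℚᵘ-toℚ (a ℕ.* b) ⟩
    ℚᵘ.mkℚᵘ (+ (a ℕ.* b)) 0                  ≃⟨ ℚᵘ.*≡* (cong (ℤ._* + 1) (pos-* a b)) ⟩
    ℚᵘ.mkℚᵘ (+ a) 0 ℚᵘ.* ℚᵘ.mkℚᵘ (+ b) 0     ≃⟨ ℚᵘ.*-cong (toℚᵘ-toℚ a) (toℚᵘ-toℚ b) ⟨
    toℚᵘ (toℚ a) ℚᵘ.* toℚᵘ (toℚ b)           ≃⟨ toℚᵘ-homo-* (toℚ a) (toℚ b) ⟨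
    toℚᵘ (toℚ a * toℚ b)                     ∎)
    where open ℚᵘ.≤-Reasoning

  ratio-*-cancel : ∀ e q → ratio e (suc q) * toℚ (suc q) ≡ toℚ e
  ratio-*-cancel e q = toℚᵘ-injective (begin-equality
    toℚᵘ (ratio e (suc q) * toℚ (suc q))        ≃⟨ toℚᵘ-homo-* (ratio e (suc q)) (toℚ (suc q)) ⟩
    toℚᵘ (ratio e (suc q)) ℚᵘ.* toℚᵘ (toℚ (suc q)) ≃⟨ ℚᵘ.*-cong (toℚᵘ-fromℚᵘ (ℚᵘ.mkℚᵘ (+ e) q)) (toℚᵘ-toℚ (suc q)) ⟩
    ℚᵘ.mkℚᵘ (+ e) q ℚᵘ.* ℚᵘ.mkℚᵘ (+ suc q) 0    ≃⟨ ℚᵘ.*≡* (reassoc (+ e) (+ suc q)) ⟩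
    ℚᵘ.mkℚᵘ (+ e) 0                             ≃⟨ toℚᵘ-toℚ e ⟨
    toℚᵘ (toℚ e)                                ∎)
    where
    open ℚᵘ.≤-Reasoning
    reassoc : ∀ x y → (x ℤ.* y) ℤ.* + 1 ≡ x ℤ.* (y ℤ.* + 1)
    reassoc = solve-∀

  toℚ-nonNeg : ∀ a → 0ℚ ≤ toℚ a
  toℚ-nonNeg a = nonNegative⁻¹ (toℚ a) {{normalize-nonNeg a 1}}

  toℚ-pos : ∀ a → 0ℚ < toℚ (suc a)
  toℚ-pos a = positive⁻¹ (toℚ (suc a)) {{normalize-pos (suc a) 1}}

  toℚ-mono-≤ : ∀ {a b} → a ℕ.≤ b → toℚ a ≤ toℚ b
  toℚ-mono-≤ {a} {b} a≤b = begin
    toℚ a                  ≡⟨ +-identityʳ (toℚ a) ⟨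
    toℚ a + 0ℚ             ≤⟨ +-monoʳ-≤ (toℚ a) (toℚ-nonNeg (b ℕ.∸ a)) ⟩
    toℚ a + toℚ (b ℕ.∸ a)  ≡⟨ toℚ-+ a (b ℕ.∸ a) ⟨
    toℚ (a ℕ.+ (b ℕ.∸ a))  ≡⟨ cong toℚ (m+[n∸m]≡n a≤b) ⟩
    toℚ b                  ∎
    where open ≤-Reasoning

module Counting where
  open import Defs hiding (sym)
  open import Data.Nat using (ℕ; zero; suc; _+_; _*_; _≤_; z≤n; s≤s)
  open import Data.Nat.Properties hiding (_≟_)
  open import Data.Nat.Tactic.RingSolver using (solve-∀)
  open import Data.Bool using (true; false; _∧_)
  open import Data.Fin using (Fin; zero; suc)
  open import Data.Fin.Properties using (_≟_)
  open import Function using (_∘_)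
  open import Relation.Nullary using (yes; no; does)
  open import Relation.Binary.PropositionalEquality

  sumFin-cong : ∀ n {f g : Fin n → ℕ} → (∀ i → f i ≡ g i) → sumFin n f ≡ sumFin n g
  sumFin-cong zero    f≗g = refl
  sumFin-cong (suc n) f≗g = cong₂ _+_ (f≗g zero) (sumFin-cong n (f≗g ∘ suc))

  sumFin-mono-≤ : ∀ n {f g : Fin n → ℕ} → (∀ i → f i ≤ g i) → sumFin n f ≤ sumFin n g
  sumFin-mono-≤ zero    f≤g = z≤n
  sumFin-mono-≤ (suc n) f≤g = +-mono-≤ (f≤g zero) (sumFin-mono-≤ n (f≤g ∘ suc))

  sumFin-const : ∀ n c → sumFin n (λ _ → c) ≡ n * c
  sumFin-const zero    c = refl
  sumFin-const (suc n) c = cong (c +_) (sumFin-const n c)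

  sumFin-+ : ∀ n (f g : Fin n → ℕ) → sumFin n (λ i → f i + g i) ≡ sumFin n f + sumFin n g
  sumFin-+ zero    f g = refl
  sumFin-+ (suc n) f g = trans (cong (f zero + g zero +_) (sumFin-+ n (f ∘ suc) (g ∘ suc)))
    (interchange (f zero) (g zero) (sumFin n (f ∘ suc)) (sumFin n (g ∘ suc)))
    where
    interchange : ∀ a b c d → a + b + (c + d) ≡ a + c + (b + d)
    interchange = solve-∀

  sumFin-comm : ∀ n m (f : Fin n → Fin m → ℕ) →
    sumFin n (λ i → sumFin m (f i)) ≡ sumFin m (λ j → sumFin n (λ i → f i j))
  sumFin-comm zero    m f = sym (trans (sumFin-const m 0) (*-zeroʳ m))
  sumFin-comm (suc n) m f = trans (cong (sumFin m (f zero) +_) (sumFin-comm n m (f ∘ suc)))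
    (sym (sumFin-+ m (f zero) (λ j → sumFin n (λ i → f (suc i) j))))

  sumFin-*ˡ : ∀ n c (f : Fin n → ℕ) → sumFin n (λ i → c * f i) ≡ c * sumFin n f
  sumFin-*ˡ zero    c f = sym (*-zeroʳ c)
  sumFin-*ˡ (suc n) c f = trans (cong (c * f zero +_) (sumFin-*ˡ n c (f ∘ suc)))
    (sym (*-distribˡ-+ c (f zero) (sumFin n (f ∘ suc))))

  sumFin-*ʳ : ∀ n c (f : Fin n → ℕ) → sumFin n (λ i → f i * c) ≡ sumFin n f * c
  sumFin-*ʳ n c f = trans (sumFin-cong n (λ i → *-comm (f i) c)) (trans (sumFin-*ˡ n c f) (*-comm c (sumFin n f)))

  indicator-≤-1 : ∀ b → indicator b ≤ 1
  indicator-≤-1 false = z≤n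
  indicator-≤-1 true  = s≤s z≤n

  indicator-∧ : ∀ a b → indicator (a ∧ b) ≡ indicator a * indicator b
  indicator-∧ false b = refl
  indicator-∧ true  b = sym (+-identityʳ (indicator b))

  indicator-∧-∧ : ∀ a b c → indicator (a ∧ b ∧ c) ≡ indicator b * indicator (a ∧ c)
  indicator-∧-∧ false false c     = refl
  indicator-∧-∧ false true  c     = refl
  indicator-∧-∧ true  false c     = refl
  indicator-∧-∧ true  true  false = refl
  indicator-∧-∧ true  true  true  = refl

  indicator-∧-∧-≤ : ∀ a b c → indicator (a ∧ b ∧ c) ≤ indicator a * indicator b
  indicator-∧-∧-≤ false b     c = z≤n
  indicator-∧-∧-≤ true  false c = z≤n
  indicator-∧-∧-≤ true  true  c = indicator-≤-1 c

  sumFin-indicator-≟ : ∀ N (x : Fin N) → sumFin N (λ p → indicator (does (x ≟ p))) ≡ 1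
  sumFin-indicator-≟ (suc N) zero    = cong suc (trans (sumFin-const N 0) (*-zeroʳ N))
  sumFin-indicator-≟ (suc N) (suc x) = sumFin-indicator-≟ N x

  sumFin-part : ∀ {n k} (cls : Fin n → Fin (suc k)) (g : Fin n → ℕ) →
    sumFin (suc k) (λ p → sumFin n (λ v → indicator (part cls p v) * g v)) ≡ sumFin n g
  sumFin-part {n} {k} cls g = begin
    sumFin (suc k) (λ p → sumFin n (λ v → indicator (part cls p v) * g v))
      ≡⟨ sumFin-comm (suc k) n (λ p v → indicator (part cls p v) * g v) ⟩
    sumFin n (λ v → sumFin (suc k) (λ p → indicator (part cls p v) * g v))
      ≡⟨ sumFin-cong n (λ v → sumFin-*ʳ (suc k) (g v) (λ p → indicator (part cls p v))) ⟩
    sumFin n (λ v → sumFin (suc k) (λ p → indicator (part cls p v)) * g v)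
      ≡⟨ sumFin-cong n (λ v → cong (_* g v) (sumFin-indicator-≟ (suc k) (cls v))) ⟩
    sumFin n (λ v → 1 * g v)
      ≡⟨ sumFin-cong n (λ v → *-identityˡ (g v)) ⟩
    sumFin n g ∎
    where open ≡-Reasoning

  sumFin-card-part : ∀ {n k} (cls : Fin n → Fin (suc k)) → sumFin (suc k) (λ p → card (part cls p)) ≡ n
  sumFin-card-part {n} {k} cls = begin
    sumFin (suc k) (λ p → card (part cls p))
      ≡⟨ sumFin-cong (suc k) (λ p → sumFin-cong n (λ v → *-identityʳ (indicator (part cls p v)))) ⟨
    sumFin (suc k) (λ p → sumFin n (λ v → indicator (part cls p v) * 1))
      ≡⟨ sumFin-part cls (λ _ → 1) ⟩
    sumFin n (λ _ → 1)
      ≡⟨ trans (sumFin-const n 1) (*-identityʳ n) ⟩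
    n ∎
    where open ≡-Reasoning

  card-part-zero+k*m : ∀ {n k m} (cls : Fin n → Fin (suc k)) →
    (∀ j → card (part cls (suc j)) ≡ m) → card (part cls zero) + k * m ≡ n
  card-part-zero+k*m {n} {k} {m} cls sizes = begin
    card (part cls zero) + k * m
      ≡⟨ cong (card (part cls zero) +_) (trans (sumFin-cong k sizes) (sumFin-const k m)) ⟨
    sumFin (suc k) (λ p → card (part cls p))
      ≡⟨ sumFin-card-part cls ⟩
    n ∎
    where open ≡-Reasoning

  sumFin-eCount-part : ∀ {n k} (G : Graph n) (cls : Fin n → Fin (suc k)) (X : VSet n) →
    sumFin (suc k) (λ p → eCount G X (part cls p)) ≡ sumFin n (λ x → indicator (X x) * deg G x)
  sumFin-eCount-part {n} {k} G cls X =
    trans (sumFin-comm (suc k) n (λ p x → sumFin n (λ y → indicator (X x ∧ part cls p y ∧ adj G x y))))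
          (sumFin-cong n row)
    where
    open ≡-Reasoning
    row : ∀ x → sumFin (suc k) (λ p → sumFin n (λ y → indicator (X x ∧ part cls p y ∧ adj G x y)))
                ≡ indicator (X x) * deg G x
    row x = begin
      sumFin (suc k) (λ p → sumFin n (λ y → indicator (X x ∧ part cls p y ∧ adj G x y)))
        ≡⟨ sumFin-cong (suc k) (λ p → sumFin-cong n (λ y → indicator-∧-∧ (X x) (part cls p y) (adj G x y))) ⟩
      sumFin (suc k) (λ p → sumFin n (λ y → indicator (part cls p y) * indicator (X x ∧ adj G x y)))
        ≡⟨ sumFin-part cls (λ y → indicator (X x ∧ adj G x y)) ⟩
      sumFin n (λ y → indicator (X x ∧ adj G x y))
        ≡⟨ sumFin-cong n (λ y → indicator-∧ (X x) (adj G x y)) ⟩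
      sumFin n (λ y → indicator (X x) * indicator (adj G x y))
        ≡⟨ sumFin-*ˡ n (indicator (X x)) (λ y → indicator (adj G x y)) ⟩
      indicator (X x) * deg G x ∎

  eCount-≤-card*card : ∀ {n} (G : Graph n) (X Y : VSet n) → eCount G X Y ≤ card X * card Y
  eCount-≤-card*card {n} G X Y = begin
    eCount G X Y
      ≤⟨ sumFin-mono-≤ n (λ x → sumFin-mono-≤ n (λ y → indicator-∧-∧-≤ (X x) (Y y) (adj G x y))) ⟩
    sumFin n (λ x → sumFin n (λ y → indicator (X x) * indicator (Y y)))
      ≡⟨ sumFin-cong n (λ x → sumFin-*ˡ n (indicator (X x)) (λ y → indicator (Y y))) ⟩
    sumFin n (λ x → indicator (X x) * card Y)
      ≡⟨ sumFin-*ʳ n (card Y) (λ x → indicator (X x)) ⟩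
    card X * card Y ∎
    where open ≤-Reasoning

  deg-≤ : ∀ {n} (G : Graph n) v → deg G v ≤ n
  deg-≤ {n} G v = begin
    deg G v                 ≤⟨ sumFin-mono-≤ n (λ u → indicator-≤-1 (adj G v u)) ⟩
    sumFin n (λ _ → 1)      ≡⟨ trans (sumFin-const n 1) (*-identityʳ n) ⟩
    n                       ∎
    where open ≤-Reasoning

  eCount-independent-part : ∀ {n k} (G : Graph n) (cls : Fin n → Fin (suc k)) p →
    (∀ u v → cls u ≡ p → cls v ≡ p → adj G u v ≡ false) → eCount G (part cls p) (part cls p) ≡ 0
  eCount-independent-part {n} G cls p indep = begin
    eCount G (part cls p) (part cls p)  ≡⟨ sumFin-cong n (λ x → sumFin-cong n (no-edge x)) ⟩
    sumFin n (λ _ → sumFin n (λ _ → 0)) ≡⟨ sumFin-cong n (λ _ → trans (sumFin-const n 0) (*-zeroʳ n)) ⟩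
    sumFin n (λ _ → 0)                  ≡⟨ trans (sumFin-const n 0) (*-zeroʳ n) ⟩
    0                                   ∎
    where
    open ≡-Reasoning
    no-edge : ∀ x y → indicator (part cls p x ∧ part cls p y ∧ adj G x y) ≡ 0
    no-edge x y with cls x ≟ p | cls y ≟ p
    ... | yes cx≡p | yes cy≡p rewrite indep x y cx≡p cy≡p = refl
    ... | yes _    | no _  = refl
    ... | no _     | _     = refl

  k*m≤n : ∀ {n k m} (cls : Fin n → Fin (suc k)) → (∀ j → card (part cls (suc j)) ≡ m) → k * m ≤ n
  k*m≤n {k = k} {m} cls sizes = subst (k * m ≤_) (card-part-zero+k*m cls sizes) (m≤n+m (k * m) _)

module Estimates where
  open import Defs hiding (sym)
  open NatToℚ
  open Counting
  open import Data.Rational.Solver using (module +-*-Solver)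
  open +-*-Solver using (solve; _:=_; con; _:+_; _:*_; _:-_)
  open import Data.Nat as ℕ using (ℕ; zero; suc; z≤n; s≤s)
  import Data.Nat.Properties as ℕₚ
  open import Data.Fin using (Fin; zero; suc; fromℕ<)
  open import Data.Fin.Properties using () renaming (_≟_ to _≟ᶠ_)
  open import Data.Integer using (+_)
  open import Data.Rational using (ℚ; 0ℚ; 1ℚ; _/_; _+_; _-_; _*_; -_; _≤_; _<_; positive; nonNegative)
  open import Data.Rational.Properties
  open import Data.Empty using (⊥-elim)
  open import Data.Unit using (tt)
  open import Data.Bool using (true; false; if_then_else_)
  open import Function using (_∘_)
  open import Relation.Nullary using (Dec; yes; no; does)
  open import Data.Sum using (_⊎_; inj₁; inj₂; [_,_]′)
  open import Data.Product using (_×_; _,_)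
  open import Relation.Binary.PropositionalEquality

  sumFin-≤-scaled-affine : ∀ k (e t : Fin k → ℕ) (M a b : ℚ) → (∀ j → toℚ (e j) ≤ M * (a * toℚ (t j) + b)) →
    toℚ (sumFin k e) ≤ M * (a * toℚ (sumFin k t) + toℚ k * b)
  sumFin-≤-scaled-affine zero    e t M a b e≤ = ≤-reflexive (empty M a b)
    where
    empty : ∀ M a b → 0ℚ ≡ M * (a * 0ℚ + 0ℚ * b)
    empty = solve 3 (λ M a b → con 0ℚ := M :* (a :* con 0ℚ :+ con 0ℚ :* b)) refl
  sumFin-≤-scaled-affine (suc k) e t M a b e≤ = begin
    toℚ (e zero ℕ.+ E)
      ≡⟨ toℚ-+ (e zero) E ⟩
    toℚ (e zero) + toℚ E
      ≤⟨ +-mono-≤ (e≤ zero) (sumFin-≤-scaled-affine k (e ∘ suc) (t ∘ suc) M a b (e≤ ∘ suc)) ⟩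
    M * (a * toℚ (t zero) + b) + M * (a * toℚ T + toℚ k * b)
      ≡⟨ collect M a b (toℚ (t zero)) (toℚ T) (toℚ k) ⟩
    M * (a * (toℚ (t zero) + toℚ T) + (1ℚ + toℚ k) * b)
      ≡⟨ cong₂ (λ x y → M * (a * x + y * b)) (toℚ-+ (t zero) T) (toℚ-+ 1 k) ⟨
    M * (a * toℚ (t zero ℕ.+ T) + toℚ (suc k) * b) ∎
    where
    open ≤-Reasoning
    E = sumFin k (e ∘ suc)
    T = sumFin k (t ∘ suc)
    collect : ∀ M a b x y K → M * (a * x + b) + M * (a * y + K * b) ≡ M * (a * (x + y) + (1ℚ + K) * b)
    collect = solve 6 (λ M a b x y K → M :* (a :* x :+ b) :+ M :* (a :* y :+ K :* b)
                                    := M :* (a :* (x :+ y) :+ (con 1ℚ :+ K) :* b)) refl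

  card-*-≤-sumFin : ∀ n (A : VSet n) (g : Fin n → ℕ) (L : ℚ) → (∀ x → A x ≡ true → L ≤ toℚ (g x)) →
    toℚ (card A) * L ≤ toℚ (sumFin n (λ x → indicator (A x) ℕ.* g x))
  card-*-≤-sumFin zero    A g L L≤g = ≤-reflexive (*-zeroˡ L)
  card-*-≤-sumFin (suc n) A g L L≤g with A zero in A₀
  ... | false = card-*-≤-sumFin n (A ∘ suc) (g ∘ suc) L (L≤g ∘ suc)
  ... | true  = begin
    toℚ (1 ℕ.+ C) * L             ≡⟨ cong (_* L) (toℚ-+ 1 C) ⟩
    (1ℚ + toℚ C) * L              ≡⟨ split L (toℚ C) ⟩
    L + toℚ C * L                 ≤⟨ +-mono-≤ (L≤g zero A₀) (card-*-≤-sumFin n (A ∘ suc) (g ∘ suc) L (L≤g ∘ suc)) ⟩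
    toℚ (g zero) + toℚ S          ≡⟨ toℚ-+ (g zero) S ⟨
    toℚ (g zero ℕ.+ S)            ≡⟨ cong (λ x → toℚ (x ℕ.+ S)) (ℕₚ.+-identityʳ (g zero)) ⟨
    toℚ (g zero ℕ.+ 0 ℕ.+ S)      ∎
    where
    open ≤-Reasoning
    C = card (A ∘ suc)
    S = sumFin n (λ x → indicator (A (suc x)) ℕ.* g (suc x))
    split : ∀ L c → (1ℚ + c) * L ≡ L + c * L
    split = solve 2 (λ L c → (con 1ℚ :+ c) :* L := L :+ c :* L) refl

  edgeMult-spec : ∀ β d → edgeMult β d ≡ 2 ⊎ (d < half + β × edgeMult β d ≡ 1) ⊎ (d < β × edgeMult β d ≡ 0)
  edgeMult-spec β d with (half + β) ≤? d
  ... | yes _ = inj₁ refl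
  ... | no d≱half+β with β ≤? d
  ...   | yes _ = inj₂ (inj₁ (≰⇒> d≱half+β , refl))
  ...   | no d≱β = inj₂ (inj₂ (≰⇒> d≱β , refl))

  ≤-half*edgeMult+ : ∀ β d → 0ℚ ≤ β → d ≤ 1ℚ → d ≤ half * toℚ (edgeMult β d) + β
  ≤-half*edgeMult+ β d 0≤β d≤1 = [ double , [ single , none ]′ ]′ (edgeMult-spec β d)
    where
    open ≤-Reasoning
    bound-by : ∀ {k} → edgeMult β d ≡ k → d ≤ half * toℚ k + β → d ≤ half * toℚ (edgeMult β d) + β
    bound-by eq = subst (λ k → d ≤ half * toℚ k + β) (sym eq)
    double : edgeMult β d ≡ 2 → d ≤ half * toℚ (edgeMult β d) + β
    double m≡2 = bound-by m≡2 (begin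
      d         ≤⟨ d≤1 ⟩
      1ℚ        ≡⟨ +-identityʳ 1ℚ ⟨
      1ℚ + 0ℚ   ≤⟨ +-monoʳ-≤ 1ℚ 0≤β ⟩
      1ℚ + β    ∎)
    single : d < half + β × edgeMult β d ≡ 1 → d ≤ half * toℚ (edgeMult β d) + β
    single (d<half+β , m≡1) = bound-by m≡1 (<⇒≤ d<half+β)
    none : d < β × edgeMult β d ≡ 0 → d ≤ half * toℚ (edgeMult β d) + β
    none (d<β , m≡0) = bound-by m≡0 (begin
      d         <⟨ d<β ⟩
      β         ≡⟨ +-identityˡ β ⟨
      0ℚ + β    ∎)

  ratio-≤-edgeMult : ∀ e N β → 0ℚ ≤ β → e ℕ.≤ N →
    toℚ e ≤ toℚ N * (half * toℚ (edgeMult β (ratio e N)) + β)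
  ratio-≤-edgeMult .0 zero    β 0≤β z≤n = ≤-reflexive (sym (*-zeroˡ (half * toℚ (edgeMult β 0ℚ) + β)))
  ratio-≤-edgeMult e  (suc q) β 0≤β e≤N = begin
    toℚ e                                     ≡⟨ ratio-*-cancel e q ⟨
    d * toℚ (suc q)                           ≤⟨ *-monoʳ-≤-nonNeg (toℚ (suc q)) {{nonNegative (toℚ-nonNeg (suc q))}}
                                                   (≤-half*edgeMult+ β d 0≤β d≤1) ⟩
    (half * toℚ (edgeMult β d) + β) * toℚ (suc q) ≡⟨ *-comm _ (toℚ (suc q)) ⟩
    toℚ (suc q) * (half * toℚ (edgeMult β d) + β) ∎
    where
    open ≤-Reasoning
    d = ratio e (suc q)
    d≤1 : d ≤ 1ℚ
    d≤1 = *-cancelʳ-≤-pos (toℚ (suc q)) {{positive (toℚ-pos q)}} (begin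
      d * toℚ (suc q)   ≡⟨ ratio-*-cancel e q ⟩
      toℚ e             ≤⟨ toℚ-mono-≤ e≤N ⟩
      toℚ (suc q)       ≡⟨ *-identityˡ (toℚ (suc q)) ⟨
      1ℚ * toℚ (suc q)  ∎)

  ≤-reducedDeg-term : ∀ {P : Set} (p? : Dec P) e N β → 0ℚ ≤ β → e ℕ.≤ N → (P → e ≡ 0) →
    toℚ e ≤ toℚ N * (half * toℚ (if does p? then 0 else edgeMult β (ratio e N)) + β)
  ≤-reducedDeg-term (no _)  e N β 0≤β e≤N _   = ratio-≤-edgeMult e N β 0≤β e≤N
  ≤-reducedDeg-term (yes p) e N β 0≤β _   e≡0 = begin
    toℚ e                         ≡⟨ cong toℚ (e≡0 p) ⟩
    0ℚ                            ≡⟨ *-zeroʳ (toℚ N) ⟨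
    toℚ N * 0ℚ                    ≤⟨ *-monoˡ-≤-nonNeg (toℚ N) {{nonNegative (toℚ-nonNeg N)}} 0≤β ⟩
    toℚ N * β                     ≡⟨ cong (toℚ N *_) (+-identityˡ β) ⟨
    toℚ N * (half * toℚ 0 + β)    ∎
    where open ≤-Reasoning

  twoOver-≤-2 : ∀ f → twoOver f ≤ toℚ 2
  twoOver-≤-2 zero    = toℚ-nonNeg 2
  twoOver-≤-2 (suc f) = *-cancelʳ-≤-pos (toℚ (suc f)) {{positive (toℚ-pos f)}} (begin
    twoOver (suc f) * toℚ (suc f)  ≡⟨ ratio-*-cancel 2 f ⟩
    toℚ 2                          ≡⟨ *-identityʳ (toℚ 2) ⟨
    toℚ 2 * 1ℚ                     ≤⟨ *-monoˡ-≤-nonNeg (toℚ 2) (toℚ-mono-≤ {1} {suc f} (s≤s z≤n)) ⟩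
    toℚ 2 * toℚ (suc f)            ∎)
    where open ≤-Reasoning

  ≤-rescale : ∀ {x y m N K} → 0ℚ ≤ x → 0ℚ < m → K * m ≤ N → x * N ≤ m * y → x * K ≤ y
  ≤-rescale {x} {y} {m} {N} {K} 0≤x 0<m Km≤N xN≤my = *-cancelˡ-≤-pos m {{positive 0<m}} (begin
    m * (x * K)  ≡⟨ solve 3 (λ m x K → m :* (x :* K) := x :* (K :* m)) refl m x K ⟩
    x * (K * m)  ≤⟨ *-monoˡ-≤-nonNeg x {{nonNegative 0≤x}} Km≤N ⟩
    x * N        ≤⟨ xN≤my ⟩
    m * y        ∎)
    where open ≤-Reasoning

  deg-≥-after-deletion : ∀ {n} (c δ N : ℚ) (G G' : Graph n) →
    (∀ v → c * N ≤ toℚ (deg G v)) → (∀ v → toℚ (deg G v) - δ * N < toℚ (deg G' v)) →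
    ∀ v → (c - δ) * N ≤ toℚ (deg G' v)
  deg-≥-after-deletion c δ N G G' degG degG' v = <⇒≤ (begin-strict
    (c - δ) * N               ≡⟨ solve 3 (λ c δ N → (c :- δ) :* N := c :* N :- δ :* N) refl c δ N ⟩
    c * N - δ * N             ≤⟨ +-monoˡ-≤ (- (δ * N)) (degG v) ⟩
    toℚ (deg G v) - δ * N     <⟨ degG' v ⟩
    toℚ (deg G' v)            ∎)
    where open ≤-Reasoning

  degree-sum-≥ : ∀ {n m} (L : ℚ) (G : Graph n) (X : VSet n) → card X ≡ m → (∀ v → L ≤ toℚ (deg G v)) →
    toℚ m * L ≤ toℚ (sumFin n (λ x → indicator (X x) ℕ.* deg G x))
  degree-sum-≥ {n} L G X refl L≤deg = card-*-≤-sumFin n X (deg G) L (λ v _ → L≤deg v)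

  degree-sum-≤ : ∀ {n k m} (ε β : ℚ) (G : Graph n) (cls : Fin n → Fin (suc k)) → 0ℚ ≤ β →
    toℚ (card (part cls zero)) ≤ ε * toℚ n →
    (∀ j → card (part cls (suc j)) ≡ m) →
    (∀ (j : Fin k) u v → cls u ≡ suc j → cls v ≡ suc j → adj G u v ≡ false) →
    ∀ i → toℚ (sumFin n (λ x → indicator (part cls (suc i) x) ℕ.* deg G x))
          ≤ toℚ m * (ε * toℚ n) + toℚ m * (toℚ m * (half * toℚ (reducedDeg G β cls i) + toℚ k * β))
  degree-sum-≤ {n} {k} {m} ε β G cls 0≤β V₀-small sizes indep i = begin
    toℚ (sumFin n (λ x → indicator (A x) ℕ.* deg G x))
      ≡⟨ cong toℚ (sumFin-eCount-part G cls A) ⟨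
    toℚ (eCount G A (V zero) ℕ.+ sumFin k e)
      ≡⟨ toℚ-+ (eCount G A (V zero)) (sumFin k e) ⟩
    toℚ (eCount G A (V zero)) + toℚ (sumFin k e)
      ≤⟨ +-mono-≤ to-V₀ (sumFin-≤-scaled-affine k e t M half β to-Vⱼ) ⟩
    mq * (ε * nq) + M * (half * D + K * β)
      ≡⟨ cong (λ x → mq * (ε * nq) + x) (*-assoc mq mq (half * D + K * β)) ⟩
    mq * (ε * nq) + mq * (mq * (half * D + K * β)) ∎
    where
    open ≤-Reasoning
    V = part cls
    A = V (suc i)
    e : Fin k → ℕ
    e j = eCount G A (V (suc j))
    t : Fin k → ℕ
    t j = if does (i ≟ᶠ j) then 0 else edgeMult β (density G A (V (suc j)))
    nq = toℚ n
    mq = toℚ m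
    M = mq * mq
    K = toℚ k
    D = toℚ (reducedDeg G β cls i)
    0≤mq : 0ℚ ≤ mq
    0≤mq = toℚ-nonNeg m
    card-A*card : ∀ p → toℚ (card A ℕ.* card (V p)) ≡ mq * toℚ (card (V p))
    card-A*card p = trans (cong (λ c → toℚ (c ℕ.* card (V p))) (sizes i)) (toℚ-* m (card (V p)))
    to-V₀ : toℚ (eCount G A (V zero)) ≤ mq * (ε * nq)
    to-V₀ = begin
      toℚ (eCount G A (V zero))                ≤⟨ toℚ-mono-≤ (eCount-≤-card*card G A (V zero)) ⟩
      toℚ (card A ℕ.* card (V zero))           ≡⟨ card-A*card zero ⟩
      mq * toℚ (card (V zero))                 ≤⟨ *-monoˡ-≤-nonNeg mq {{nonNegative 0≤mq}} V₀-small ⟩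
      mq * (ε * nq)                            ∎
    to-Vⱼ : ∀ j → toℚ (e j) ≤ M * (half * toℚ (t j) + β)
    to-Vⱼ j = begin
      toℚ (e j)                                                   ≤⟨ ≤-reducedDeg-term (i ≟ᶠ j) (e j) _ β 0≤β
                                                                       (eCount-≤-card*card G A (V (suc j))) A-independent ⟩
      toℚ (card A ℕ.* card (V (suc j))) * (half * toℚ (t j) + β)  ≡⟨ cong (_* (half * toℚ (t j) + β)) |A||Vⱼ|≡M ⟩
      M * (half * toℚ (t j) + β)                                  ∎
      where
      A-independent : i ≡ j → e j ≡ 0
      A-independent refl = eCount-independent-part G cls (suc i) (indep i)
      |A||Vⱼ|≡M : toℚ (card A ℕ.* card (V (suc j))) ≡ M
      |A||Vⱼ|≡M = trans (card-A*card (suc j)) (cong (λ c → mq * toℚ c) (sizes j))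

  degree-bound-from-edge-count : ∀ (a μ β ε m N K D : ℚ) →
    0ℚ ≤ μ → 0ℚ ≤ β → β ≤ μ * (+ 1 / 10) → ε ≤ μ * (+ 1 / 10) →
    0ℚ < m → 0ℚ ≤ K → 0ℚ ≤ D → K * m ≤ N →
    m * ((a + μ - (β + ε)) * N) ≤ m * (ε * N) + m * (m * (half * D + K * β)) →
    (+ 2 / 1) * (a + μ * half) * K ≤ D
  degree-bound-from-edge-count a μ β ε m N K D 0≤μ 0≤β β≤ ε≤ 0<m 0≤K 0≤D Km≤N count = begin
    (+ 2 / 1) * (a + μ * half) * K
      ≤⟨ *-monoʳ-≤-nonNeg K {{nonNegative 0≤K}} (*-monoˡ-≤-nonNeg (+ 2 / 1) margin) ⟩
    (+ 2 / 1) * (x - β) * K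
      ≤⟨ by-sign (0ℚ ≤? x) ⟩
    D ∎
    where
    open ≤-Reasoning
    x = a + μ - (β + ε) - ε
    Y = half * D + K * β

    2β+2ε≤μ/2 : β + β + (ε + ε) ≤ μ * half
    2β+2ε≤μ/2 = begin
      β + β + (ε + ε)
        ≤⟨ +-mono-≤ (+-mono-≤ β≤ β≤) (+-mono-≤ ε≤ ε≤) ⟩
      μ * (+ 1 / 10) + μ * (+ 1 / 10) + (μ * (+ 1 / 10) + μ * (+ 1 / 10))
        ≡⟨ solve 1 (λ μ → μ :* con (+ 1 / 10) :+ μ :* con (+ 1 / 10) :+ (μ :* con (+ 1 / 10) :+ μ :* con (+ 1 / 10))
                          := μ :* con (+ 2 / 5)) refl μ ⟩
      μ * (+ 2 / 5)
        ≤⟨ *-monoˡ-≤-nonNeg μ {{nonNegative 0≤μ}} (≤ᵇ⇒≤ tt) ⟩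
      μ * half ∎

    margin : a + μ * half ≤ x - β
    margin = begin
      a + μ * half
        ≡⟨ solve 2 (λ a μ → a :+ μ :* con half := a :+ μ :- μ :* con half) refl a μ ⟩
      a + μ - μ * half
        ≤⟨ +-monoʳ-≤ (a + μ) (neg-antimono-≤ 2β+2ε≤μ/2) ⟩
      a + μ - (β + β + (ε + ε))
        ≡⟨ solve 4 (λ a μ β ε → a :+ μ :- (β :+ β :+ (ε :+ ε)) := a :+ μ :- (β :+ ε) :- ε :- β) refl a μ β ε ⟩
      x - β ∎

    xN≤mY : x * N ≤ m * Y
    xN≤mY = *-cancelˡ-≤-pos m {{positive 0<m}} (begin
      m * (x * N)
        ≡⟨ solve 4 (λ m c ε N → m :* ((c :- ε) :* N) := m :* (c :* N) :- m :* (ε :* N)) refl m (a + μ - (β + ε)) ε N ⟩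
      m * ((a + μ - (β + ε)) * N) - m * (ε * N)
        ≤⟨ +-monoˡ-≤ (- (m * (ε * N))) count ⟩
      m * (ε * N) + m * (m * Y) - m * (ε * N)
        ≡⟨ solve 2 (λ P Q → P :+ Q :- P := Q) refl (m * (ε * N)) (m * (m * Y)) ⟩
      m * (m * Y) ∎)

    by-sign : Dec (0ℚ ≤ x) → (+ 2 / 1) * (x - β) * K ≤ D
    by-sign (yes 0≤x) = begin
      (+ 2 / 1) * (x - β) * K
        ≡⟨ solve 3 (λ x β K → con (+ 2 / 1) :* (x :- β) :* K := con (+ 2 / 1) :* (x :* K :- K :* β)) refl x β K ⟩
      (+ 2 / 1) * (x * K - K * β)
        ≤⟨ *-monoˡ-≤-nonNeg (+ 2 / 1) (+-monoˡ-≤ (- (K * β)) (≤-rescale 0≤x 0<m Km≤N xN≤mY)) ⟩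
      (+ 2 / 1) * (half * D + K * β - K * β)
        ≡⟨ solve 2 (λ D Z → con (+ 2 / 1) :* (con half :* D :+ Z :- Z) := D) refl D (K * β) ⟩
      D ∎
    by-sign (no x≱0) = begin
      (+ 2 / 1) * (x - β) * K
        ≤⟨ *-monoʳ-≤-nonNeg K {{nonNegative 0≤K}} (*-monoˡ-≤-nonNeg (+ 2 / 1) x-β≤0) ⟩
      (+ 2 / 1) * 0ℚ * K
        ≡⟨ solve 1 (λ K → con (+ 2 / 1) :* con 0ℚ :* K := con 0ℚ) refl K ⟩
      0ℚ
        ≤⟨ 0≤D ⟩
      D ∎
      where
      x-β≤0 : x - β ≤ 0ℚ
      x-β≤0 = begin
        x - β    ≤⟨ +-monoʳ-≤ x (neg-antimono-≤ 0≤β) ⟩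
        x + 0ℚ   ≡⟨ +-identityʳ x ⟩
        x        <⟨ ≰⇒> x≱0 ⟩
        0ℚ       ∎

  cluster-size-positive : ∀ {n k m} (μ ε : ℚ) (fH : ℕ) (G : Graph n) (cls : Fin n → Fin (suc k)) →
    1 ℕ.≤ n → ε ≤ μ * (+ 1 / 10) →
    (∀ v → (1ℚ - twoOver fH + μ) * toℚ n ≤ toℚ (deg G v)) →
    toℚ (card (part cls zero)) ≤ ε * toℚ n →
    (∀ j → card (part cls (suc j)) ≡ m) →
    0ℚ < toℚ m
  cluster-size-positive {m = suc m'} μ ε fH G cls 1≤n ε≤ degG V₀-small sizes = toℚ-pos m'
  cluster-size-positive {n} {k} {zero} μ ε fH G cls 1≤n ε≤ degG V₀-small sizes = ⊥-elim (≤⇒≤ᵇ 9≤1)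
    where
    open ≤-Reasoning
    nq = toℚ n
    0<n : 0ℚ < nq
    0<n = <-≤-trans (toℚ-pos 0) (toℚ-mono-≤ 1≤n)
    V₀-is-everything : card (part cls zero) ≡ n
    V₀-is-everything = trans (sym (trans (cong (card (part cls zero) ℕ.+_) (ℕₚ.*-zeroʳ k)) (ℕₚ.+-identityʳ _)))
                             (card-part-zero+k*m cls sizes)
    1≤ε : 1ℚ ≤ ε
    1≤ε = *-cancelʳ-≤-pos nq {{positive 0<n}} (begin
      1ℚ * nq                    ≡⟨ *-identityˡ nq ⟩
      nq                         ≡⟨ cong toℚ V₀-is-everything ⟨
      toℚ (card (part cls zero)) ≤⟨ V₀-small ⟩
      ε * nq                     ∎)
    v = fromℕ< 1≤n
    coefficient≤1 : 1ℚ - twoOver fH + μ ≤ 1ℚ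
    coefficient≤1 = *-cancelʳ-≤-pos nq {{positive 0<n}} (begin
      (1ℚ - twoOver fH + μ) * nq ≤⟨ degG v ⟩
      toℚ (deg G v)              ≤⟨ toℚ-mono-≤ (deg-≤ G v) ⟩
      nq                         ≡⟨ *-identityˡ nq ⟨
      1ℚ * nq                    ∎)
    10≤μ : toℚ 10 ≤ μ
    10≤μ = begin
      toℚ 10                       ≡⟨ *-identityˡ (toℚ 10) ⟨
      1ℚ * toℚ 10                  ≤⟨ *-monoʳ-≤-nonNeg (toℚ 10) (≤-trans 1≤ε ε≤) ⟩
      μ * (+ 1 / 10) * toℚ 10      ≡⟨ solve 1 (λ μ → μ :* con (+ 1 / 10) :* con (toℚ 10) := μ) refl μ ⟩
      μ                            ∎
    9≤1 : toℚ 9 ≤ 1ℚ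
    9≤1 = begin
      toℚ 9                        ≡⟨⟩
      1ℚ - toℚ 2 + toℚ 10          ≤⟨ +-mono-≤ (+-monoʳ-≤ 1ℚ (neg-antimono-≤ (twoOver-≤-2 fH))) 10≤μ ⟩
      1ℚ - twoOver fH + μ          ≤⟨ coefficient≤1 ⟩
      1ℚ                           ∎

open import Defs
open import Data.Nat using (ℕ; suc; _≤_)
open import Data.Fin using (Fin; zero; suc)
open import Data.Bool using (false)
open import Data.Sum using (_⊎_)
open import Data.Product using (_×_)
open import Data.Integer using (+_)
open import Data.Rational using (ℚ; 0ℚ; 1ℚ; _/_; _+_; _-_; _*_; _<_) renaming (_≤_ to _≤ℚ_)
open import Relation.Binary.PropositionalEquality using (_≡_; _≢_)

open import Data.Rational.Properties using (<⇒≤; ≤-trans)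
open import Relation.Binary.PropositionalEquality using (subst)
open NatToℚ using (toℚ-nonNeg; toℚ-mono-≤; toℚ-*)
open Counting using (k*m≤n)
open Estimates

fact3p7 : (n h : ℕ) (μ ε β : ℚ) →
  0ℚ < μ → (ε>0 : 0ℚ < ε) → 0ℚ < β → ε ≤ℚ μ * (+ 1 / 10) → β ≤ℚ μ * (+ 1 / 10) → β ≤ℚ 1ℚ →
  1 ≤ h → 1 ≤ n →
  (H : Graph h) (fH : ℕ) → IsF H fH →
  (G : Graph n) →
  (∀ v → (1ℚ - twoOver fH + μ) * toℚ n ≤ℚ toℚ (deg G v)) →
  (Nε : ℕ) (k m : ℕ) (cls : Fin n → Fin (suc k)) (G' : Graph n) → G' ⊑ G →
  recip ε ε>0 ≤ℚ toℚ k → k ≤ Nε →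
  (∀ i → toℚ (card (part cls i)) ≤ℚ ε * toℚ n) →
  (∀ (i : Fin k) → card (part cls (suc i)) ≡ m) →
  (∀ v → toℚ (deg G v) - (β + ε) * toℚ n < toℚ (deg G' v)) →
  (∀ (i : Fin k) u v → cls u ≡ suc i → cls v ≡ suc i → adj G' u v ≡ false) →
  (∀ (i j : Fin k) → i ≢ j →
     IsRegular G' ε (part cls (suc i)) (part cls (suc j)) ×
     (density G' (part cls (suc i)) (part cls (suc j)) ≡ 0ℚ
       ⊎ β ≤ℚ density G' (part cls (suc i)) (part cls (suc j)))) →
  ∀ (i : Fin k) →
    (+ 2 / 1) * (1ℚ - twoOver fH + μ * half) * toℚ k ≤ℚ toℚ (reducedDeg G' β cls i)
fact3p7 n _ μ ε β 0<μ _ 0<β ε≤ β≤ _ _ 1≤n _ fH _ G δG _ k m cls G' _ _ _ parts-small sizes δG' indep _ i =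
  degree-bound-from-edge-count (1ℚ - twoOver fH) μ β ε (toℚ m) (toℚ n) (toℚ k) (toℚ (reducedDeg G' β cls i))
    (<⇒≤ 0<μ) 0≤β β≤ ε≤ 0<m (toℚ-nonNeg k) (toℚ-nonNeg (reducedDeg G' β cls i)) km≤n
    (≤-trans (degree-sum-≥ _ G' (part cls (suc i)) (sizes i) δG'-bound)
             (degree-sum-≤ ε β G' cls 0≤β (parts-small zero) sizes indep i))
  where
  0≤β = <⇒≤ 0<β
  0<m : 0ℚ < toℚ m
  0<m = cluster-size-positive μ ε fH G cls 1≤n ε≤ δG (parts-small zero) sizes
  km≤n : toℚ k * toℚ m ≤ℚ toℚ n
  km≤n = subst (_≤ℚ toℚ n) (toℚ-* k m) (toℚ-mono-≤ (k*m≤n cls sizes))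
  δG'-bound : ∀ v → (1ℚ - twoOver fH + μ - (β + ε)) * toℚ n ≤ℚ toℚ (deg G' v)
  δG'-bound = deg-≥-after-deletion (1ℚ - twoOver fH + μ) (β + ε) (toℚ n) G G' δG δG'
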